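{- Let $G$ be a finite simple graph and let $H$ be a spanning subgraph of $G$ (so $V(H)=V(G)$ and $E(H)\subseteq E(G)$). If $\mathrm{Aut}(H)\subseteq \mathrm{Aut}(G)$ (as sets of permutations of the common vertex set), then $\chi_D(H)\leq \chi_D(G)$.
   Context: $\mathrm{Aut}(G)$ denotes the automorphism group of $G$. A labeling $f:V(G)\to\{1,\dots,r\}$ is proper if adjacent vertices receive different labels, and distinguishing if the only automorphism $\sigma$ of $G$ with $f(\sigma(x))=f(x)$ for all vertices $x$ is the identity. The distinguishing chromatic number $\chi_D(G)$ is the minimum $r$ such that $G$ has a labeling with $r$ labels that is both proper and distinguishing. -}

module Defs where

open import Level using (0ℓ)
open import Data.Nat using (ℕ; _≤_)
open import Data.Fin using (Fin)
open import Data.Fin.Permutation using (Permutation′; _⟨$⟩ʳ_)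
open import Data.Product using (_×_; Σ-syntax)
open import Relation.Binary.PropositionalEquality using (_≡_)
open import Relation.Nullary using (¬_)
open import Relation.Binary using (Rel; Symmetric; Irreflexive)

record Graph (n : ℕ) : Set₁ where
  field
    Adj   : Rel (Fin n) 0ℓ
    sym   : Symmetric Adj
    irrefl : Irreflexive _≡_ Adj
open Graph public

SpanningSubgraph : {n : ℕ} → Graph n → Graph n → Set
SpanningSubgraph H G = ∀ x y → Adj H x y → Adj G x y

IsAut : {n : ℕ} → Graph n → Permutation′ n → Set
IsAut G σ = ∀ x y → (Adj G x y → Adj G (σ ⟨$⟩ʳ x) (σ ⟨$⟩ʳ y))
                   × (Adj G (σ ⟨$⟩ʳ x) (σ ⟨$⟩ʳ y) → Adj G x y)

-- An r-labeling uses labels {1,…,r}, represented as Fin r.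
Proper : {n r : ℕ} → Graph n → (Fin n → Fin r) → Set
Proper G f = ∀ x y → Adj G x y → ¬ (f x ≡ f y)

Distinguishing : {n r : ℕ} → Graph n → (Fin n → Fin r) → Set
Distinguishing {n} G f =
  ∀ (σ : Permutation′ n) → IsAut G σ → (∀ x → f (σ ⟨$⟩ʳ x) ≡ f x) →
  ∀ x → σ ⟨$⟩ʳ x ≡ x

HasPDLabeling : {n : ℕ} → Graph n → ℕ → Set
HasPDLabeling {n} G r = Σ[ f ∈ (Fin n → Fin r) ] (Proper G f × Distinguishing G f)

IsDistChromNum : {n : ℕ} → Graph n → ℕ → Set
IsDistChromNum G k = HasPDLabeling G k × (∀ r → HasPDLabeling G r → k ≤ r)

module Submission where

open import Defs
open import Data.Nat using (ℕ; _≤_)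
open import Data.Fin using (Fin)
open import Data.Fin.Permutation using (Permutation′)
open import Data.Product using (_,_)

-- A proper distinguishing labeling of G is one of H: H has fewer edges to
-- respect and, since Aut(H) ⊆ Aut(G), fewer automorphisms to break.

AutSubset : {n : ℕ} → Graph n → Graph n → Set
AutSubset {n} H G = ∀ (σ : Permutation′ n) → IsAut H σ → IsAut G σ

Proper-mono : ∀ {n r} (G H : Graph n) (f : Fin n → Fin r) →
  SpanningSubgraph H G → Proper G f → Proper H f
Proper-mono G H f H⊆G proper x y adj = proper x y (H⊆G x y adj)

Distinguishing-antimono : ∀ {n r} (G H : Graph n) (f : Fin n → Fin r) →
  AutSubset H G → Distinguishing G f → Distinguishing H f
Distinguishing-antimono G H f AutH⊆AutG distinguishing σ σ∈AutH =
  distinguishing σ (AutH⊆AutG σ σ∈AutH)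

HasPDLabeling-transfer : ∀ {n r} (G H : Graph n) →
  SpanningSubgraph H G → AutSubset H G → HasPDLabeling G r → HasPDLabeling H r
HasPDLabeling-transfer G H H⊆G AutH⊆AutG (f , proper , distinguishing) =
  f , Proper-mono G H f H⊆G proper
    , Distinguishing-antimono G H f AutH⊆AutG distinguishing

mainTheorem3 : (n : ℕ) (G H : Graph n) → SpanningSubgraph H G →
    (∀ (σ : Permutation′ n) → IsAut H σ → IsAut G σ) →
    (kG kH : ℕ) → IsDistChromNum G kG → IsDistChromNum H kH → kH ≤ kG
mainTheorem3 n G H H⊆G AutH⊆AutG kG kH (labelingG , _) (_ , minimalH) =
  minimalH kG (HasPDLabeling-transfer G H H⊆G AutH⊆AutG labelingG)
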